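{- The membership problem in $\mathbf{L}_{\min}$ (given a formula $A$, decide whether $A\in\mathbf{L}_{\min}$) is decidable.
   Context: Formulas are built from a countably infinite set of atoms by $A::=p\mid (A\rightarrow A)\mid\top\mid\bot\mid(A\vee A)\mid(A\wedge A)\mid\square A\mid\lozenge A$; $\neg A$ abbreviates $A\rightarrow\bot$. An intuitionistic modal logic is a set of formulas closed under uniform substitution, containing the axioms of intuitionistic propositional logic, closed under modus ponens, containing (A1) $\square(p\rightarrow q)\rightarrow(\square p\rightarrow\square q)$, (A2) $\square(p\vee q)\rightarrow((\lozenge p\rightarrow\square q)\rightarrow\square q)$, (A3) $\lozenge(p\vee q)\rightarrow\lozenge p\vee\lozenge q$, (A4) $\neg\lozenge\bot$, and closed under the rules (R1) from $p$ infer $\square p$, (R2) from $p\rightarrow q$ infer $\lozenge p\rightarrow\lozenge q$, (R3) from $\lozenge p\rightarrow q\vee\square(p\rightarrow r)$ infer $\lozenge p\rightarrow q\vee\lozenge r$. $\mathbf{L}_{\min}$ is the least intuitionistic modal logic. -}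

module Defs where

open import Data.Nat using (ℕ)

infixr 5 _⇒_
infixr 6 _∨ᶠ_
infixr 7 _∧ᶠ_
data Formula : Set where
  atom  : ℕ → Formula
  _⇒_   : Formula → Formula → Formula
  ⊤ᶠ    : Formula
  ⊥ᶠ    : Formula
  _∨ᶠ_  : Formula → Formula → Formula
  _∧ᶠ_  : Formula → Formula → Formula
  □_    : Formula → Formula
  ◇_    : Formula → Formula

¬ᶠ_ : Formula → Formula
¬ᶠ A = A ⇒ ⊥ᶠ

_[_] : Formula → (ℕ → Formula) → Formula
atom n [ σ ] = σ n
(A ⇒ B) [ σ ] = (A [ σ ]) ⇒ (B [ σ ])
⊤ᶠ [ σ ] = ⊤ᶠ
⊥ᶠ [ σ ] = ⊥ᶠ
(A ∨ᶠ B) [ σ ] = (A [ σ ]) ∨ᶠ (B [ σ ])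
(A ∧ᶠ B) [ σ ] = (A [ σ ]) ∧ᶠ (B [ σ ])
(□ A) [ σ ] = □ (A [ σ ])
(◇ A) [ σ ] = ◇ (A [ σ ])

p q r : Formula
p = atom 0
q = atom 1
r = atom 2

-- Axioms (stated with distinct atoms; closure under substitution yields all instances).
-- Standard Hilbert axioms of intuitionistic propositional logic: IPC1 … IPC10.
-- Modal axioms A1 … A4.
data Axiom : Formula → Set where
  ipc1  : Axiom (p ⇒ (q ⇒ p))
  ipc2  : Axiom ((p ⇒ (q ⇒ r)) ⇒ ((p ⇒ q) ⇒ (p ⇒ r)))
  ipc3  : Axiom ((p ∧ᶠ q) ⇒ p)
  ipc4  : Axiom ((p ∧ᶠ q) ⇒ q)
  ipc5  : Axiom (p ⇒ (q ⇒ (p ∧ᶠ q)))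
  ipc6  : Axiom (p ⇒ (p ∨ᶠ q))
  ipc7  : Axiom (q ⇒ (p ∨ᶠ q))
  ipc8  : Axiom ((p ⇒ r) ⇒ ((q ⇒ r) ⇒ ((p ∨ᶠ q) ⇒ r)))
  ipc9  : Axiom (⊥ᶠ ⇒ p)
  ipc10 : Axiom ⊤ᶠ
  a1    : Axiom (□ (p ⇒ q) ⇒ (□ p ⇒ □ q))
  a2    : Axiom (□ (p ∨ᶠ q) ⇒ ((◇ p ⇒ □ q) ⇒ □ q))
  a3    : Axiom (◇ (p ∨ᶠ q) ⇒ (◇ p ∨ᶠ ◇ q))
  a4    : Axiom (¬ᶠ (◇ ⊥ᶠ))

data Lmin : Formula → Set where
  ax    : ∀ {A} → Axiom A → Lmin A
  usub  : ∀ {A} (σ : ℕ → Formula) → Lmin A → Lmin (A [ σ ])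
  mp    : ∀ {A B} → Lmin (A ⇒ B) → Lmin A → Lmin B
  r1    : ∀ {A} → Lmin A → Lmin (□ A)
  r2    : ∀ {A B} → Lmin (A ⇒ B) → Lmin (◇ A ⇒ ◇ B)
  r3    : ∀ {A B C} → Lmin (◇ A ⇒ (B ∨ᶠ □ (A ⇒ C))) → Lmin (◇ A ⇒ (B ∨ᶠ ◇ C))

-- L_min is sound for birelational Kripke models (≼ intuitionistic, R modal, and ◇A
-- true at x when some ≼-predecessor of x sees an A-world), so refutable formulas are
-- not theorems.  Conversely, let S be the subformulas of A and take every subset of S
-- as a candidate world; call w inconsistent when ⋀(S ∩ w) ⇒ ⋁(S ∖ w) is in L_min.
-- Repeatedly discard the candidates that violate a local condition or leave a ⇒-, □-
-- or ◇-demand unrealised: each discarded world is inconsistent, which is shown by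
-- cutting on every formula of S and appealing to A2 for □ and to R3 for ◇.  Once
-- nothing more is discarded, the survivors form a finite model obeying a truth lemma.
-- If some survivor omits A it refutes A; otherwise every consistent world contains A,
-- and cutting on S derives A.

module Submission where

open import Defs
open import Data.Bool using (Bool; true; false; T; T?; _∧_)
open import Data.Bool.Properties using (T-∧)
open import Data.Empty using (⊥; ⊥-elim)
open import Data.List using (List; []; _∷_; _++_; map; concatMap; filter; length)
open import Data.List.Membership.Propositional using (_∈_; _∉_; find; lose)
open import Data.List.Membership.Propositional.Properties using (∈-filter⁺; ∈-filter⁻; ∈-map⁺; ∈-map⁻; ∈-++⁺ˡ; ∈-++⁺ʳ; ∈-++⁻; ∈-concatMap⁺; ∈-concatMap⁻)
open import Data.List.Properties using (++-identityʳ; filter-notAll)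
open import Data.List.Relation.Binary.Permutation.Propositional.Properties using (shift)
open import Data.List.Relation.Binary.Subset.Propositional using (_⊆_)
open import Data.List.Relation.Binary.Subset.Propositional.Properties using (∷⁺ʳ; ⊆-reflexive; ⊆-trans; ++⁺ʳ; ⊆-reflexive-↭; concatMap⁺)
import Data.List.Relation.Unary.All as All
open import Data.List.Relation.Unary.All using (all?)
open import Data.List.Relation.Unary.All.Properties using (¬All⇒Any¬)
import Data.List.Relation.Unary.Any as Any
open import Data.List.Relation.Unary.Any using (here; there; any?)
open import Data.Maybe using (is-just)
open import Data.Nat using (ℕ; _≡ᵇ_; _≤_; _<_; z≤n; s≤s)
open import Data.Nat.Induction using (<-wellFounded)
open import Data.Nat.Properties using (≡ᵇ⇒≡; ≡⇒≡ᵇ; m≤n⇒m≤1+n; <-≤-trans)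
open import Data.Product using (Σ; ∃; _×_; _,_; proj₁; proj₂; swap)
open import Data.Sum using (_⊎_; inj₁; inj₂; isInj₁)
open import Data.Unit using (⊤; tt)
open import Function using (_∘_; _⇔_; mk⇔; Equivalence)
open import Induction.WellFounded using (Acc; acc)
open import Relation.Binary.Definitions using (DecidableEquality)
open import Relation.Binary.PropositionalEquality using (_≡_; refl; cong; cong₂)
open import Relation.Nullary using (Dec; yes; no; ¬_)
open import Relation.Nullary.Decidable using (map′; _×-dec_; decidable-stable)
open import Relation.Unary using (Decidable)

search : ∀ {A : Set} {P : A → Set} → Decidable P → ∀ xs → Dec (∃ λ x → x ∈ xs × P x)
search P? xs = map′ find (λ (_ , m , p) → lose m p) (any? P? xs)

all-or : ∀ {A : Set} {P : A → Set} {X : Set} xs → (∀ {x} → x ∈ xs → P x ⊎ X) → (∀ {x} → x ∈ xs → P x) ⊎ X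
all-or [] f = inj₁ λ ()
all-or (x ∷ xs) f with f (here refl) | all-or xs (f ∘ there)
... | inj₂ e | _ = inj₂ e
... | inj₁ _ | inj₂ e = inj₂ e
... | inj₁ p | inj₁ g = inj₁ λ { (here refl) → p ; (there m) → g m }

module _ {A : Set} {P Q : A → Set} (classify : ∀ x → P x ⊎ Q x) where
  ClassifiedLeft : A → Set
  ClassifiedLeft x = T (is-just (isInj₁ (classify x)))

  classifiedLeft? : Decidable ClassifiedLeft
  classifiedLeft? x = T? _

  classifiedLeft⇒ : ∀ {x} → ClassifiedLeft x → P x
  classifiedLeft⇒ {x} l with classify x
  ... | inj₁ p = p

  ¬classifiedLeft⇒ : ∀ {x} → ¬ ClassifiedLeft x → Q x
  ¬classifiedLeft⇒ {x} ¬l with classify x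
  ... | inj₁ _ = ⊥-elim (¬l tt)
  ... | inj₂ q = q

module _ {A : Set} {P Q : A → Set} (P? : Decidable P) (Q? : Decidable Q) where
  length-filter-mono : ∀ xs → (∀ {x} → x ∈ xs → P x → Q x) → length (filter P? xs) ≤ length (filter Q? xs)
  length-filter-mono [] f = z≤n
  length-filter-mono (x ∷ xs) f with P? x | Q? x
  ... | yes _ | yes _ = s≤s (length-filter-mono xs (f ∘ there))
  ... | yes p | no ¬q = ⊥-elim (¬q (f (here refl) p))
  ... | no _  | yes _ = m≤n⇒m≤1+n (length-filter-mono xs (f ∘ there))
  ... | no _  | no _  = length-filter-mono xs (f ∘ there)

  length-filter-mono-< : ∀ xs → (∀ {x} → x ∈ xs → P x → Q x) → ∀ {y} → y ∈ xs → Q y → ¬ P y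
                       → length (filter P? xs) < length (filter Q? xs)
  length-filter-mono-< (x ∷ xs) f (here refl) q ¬p with P? x | Q? x
  ... | yes p | _     = ⊥-elim (¬p p)
  ... | no _  | yes _ = s≤s (length-filter-mono xs (f ∘ there))
  ... | no _  | no ¬q = ⊥-elim (¬q q)
  length-filter-mono-< (x ∷ xs) f (there m) q ¬p with P? x | Q? x
  ... | yes _ | yes _ = s≤s (length-filter-mono-< xs (f ∘ there) m q ¬p)
  ... | yes p | no ¬q = ⊥-elim (¬q (f (here refl) p))
  ... | no _  | yes _ = m≤n⇒m≤1+n (length-filter-mono-< xs (f ∘ there) m q ¬p)
  ... | no _  | no _  = length-filter-mono-< xs (f ∘ there) m q ¬p

sublists : ∀ {A : Set} → List A → List (List A)
sublists [] = [] ∷ []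
sublists (x ∷ xs) = map (x ∷_) (sublists xs) ++ sublists xs

filter-∈-sublists : ∀ {A : Set} {P : A → Set} (P? : Decidable P) xs → filter P? xs ∈ sublists xs
filter-∈-sublists P? [] = here refl
filter-∈-sublists P? (x ∷ xs) with P? x
... | yes _ = ∈-++⁺ˡ (∈-map⁺ (x ∷_) (filter-∈-sublists P? xs))
... | no _ = ∈-++⁺ʳ _ (filter-∈-sublists P? xs)

-- Natural deduction over L_min

⟨_,_,_⟩ : Formula → Formula → Formula → ℕ → Formula
⟨ X , Y , Z ⟩ 0 = X
⟨ X , Y , Z ⟩ 1 = Y
⟨ X , Y , Z ⟩ _ = Z

axiom : ∀ {A} → Axiom A → ∀ X Y Z → Lmin (A [ ⟨ X , Y , Z ⟩ ])
axiom a X Y Z = usub ⟨ X , Y , Z ⟩ (ax a)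

Lmin-K : ∀ X Y → Lmin (X ⇒ Y ⇒ X)
Lmin-K X Y = axiom ipc1 X Y ⊤ᶠ

Lmin-S : ∀ X Y Z → Lmin ((X ⇒ Y ⇒ Z) ⇒ (X ⇒ Y) ⇒ X ⇒ Z)
Lmin-S = axiom ipc2

Lmin-I : ∀ X → Lmin (X ⇒ X)
Lmin-I X = mp (mp (Lmin-S X (X ⇒ X) X) (Lmin-K X (X ⇒ X))) (Lmin-K X X)

_⇒*_ : List Formula → Formula → Formula
[] ⇒* A = A
(X ∷ Γ) ⇒* A = Γ ⇒* (X ⇒ A)

⇒*-const : ∀ Γ {A} → Lmin A → Lmin (Γ ⇒* A)
⇒*-const [] a = a
⇒*-const (X ∷ Γ) {A} a = ⇒*-const Γ (mp (Lmin-K A X) a)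

⇒*-mp : ∀ Γ {A B} → Lmin (Γ ⇒* (A ⇒ B)) → Lmin (Γ ⇒* A) → Lmin (Γ ⇒* B)
⇒*-mp [] f a = mp f a
⇒*-mp (X ∷ Γ) {A} {B} f a = ⇒*-mp Γ (⇒*-mp Γ (⇒*-const Γ (Lmin-S X A B)) f) a

⇒*-mp₂ : ∀ Γ {A B C} → Lmin (A ⇒ B ⇒ C) → Lmin (Γ ⇒* A) → Lmin (Γ ⇒* B) → Lmin (Γ ⇒* C)
⇒*-mp₂ Γ t a b = ⇒*-mp Γ (⇒*-mp Γ (⇒*-const Γ t) a) b

⇒*-hyp : ∀ Γ {A} → A ∈ Γ → Lmin (Γ ⇒* A)
⇒*-hyp (X ∷ Γ) (here refl) = ⇒*-const Γ (Lmin-I X)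
⇒*-hyp (X ∷ Γ) {A} (there m) = ⇒*-mp Γ (⇒*-const Γ (Lmin-K A X)) (⇒*-hyp Γ m)

infix 3 _⊢_
data _⊢_ (Γ : List Formula) : Formula → Set where
  hyp   : ∀ {A} → A ∈ Γ → Γ ⊢ A
  lam   : ∀ {A B} → A ∷ Γ ⊢ B → Γ ⊢ A ⇒ B
  app   : ∀ {A B} → Γ ⊢ A ⇒ B → Γ ⊢ A → Γ ⊢ B
  pair  : ∀ {A B} → Γ ⊢ A → Γ ⊢ B → Γ ⊢ A ∧ᶠ B
  fst   : ∀ {A B} → Γ ⊢ A ∧ᶠ B → Γ ⊢ A
  snd   : ∀ {A B} → Γ ⊢ A ∧ᶠ B → Γ ⊢ B
  inl   : ∀ {A B} → Γ ⊢ A → Γ ⊢ A ∨ᶠ B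
  inr   : ∀ {A B} → Γ ⊢ B → Γ ⊢ A ∨ᶠ B
  case  : ∀ {A B C} → Γ ⊢ A ∨ᶠ B → A ∷ Γ ⊢ C → B ∷ Γ ⊢ C → Γ ⊢ C
  abort : ∀ {A} → Γ ⊢ ⊥ᶠ → Γ ⊢ A
  triv  : Γ ⊢ ⊤ᶠ
  thm   : ∀ {A} → Lmin A → Γ ⊢ A

v₀ : ∀ {Γ A} → A ∷ Γ ⊢ A
v₀ = hyp (here refl)

v₁ : ∀ {Γ A B} → B ∷ A ∷ Γ ⊢ A
v₁ = hyp (there (here refl))

deduction : ∀ {Γ A} → Γ ⊢ A → Lmin (Γ ⇒* A)
deduction {Γ} (hyp m) = ⇒*-hyp Γ m
deduction (lam d) = deduction d
deduction {Γ} (app d e) = ⇒*-mp Γ (deduction d) (deduction e)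
deduction {Γ} {A ∧ᶠ B} (pair d e) = ⇒*-mp₂ Γ (axiom ipc5 A B ⊤ᶠ) (deduction d) (deduction e)
deduction {Γ} {A} (fst {B = B} d) = ⇒*-mp Γ (⇒*-const Γ (axiom ipc3 A B ⊤ᶠ)) (deduction d)
deduction {Γ} {B} (snd {A = A} d) = ⇒*-mp Γ (⇒*-const Γ (axiom ipc4 A B ⊤ᶠ)) (deduction d)
deduction {Γ} {A ∨ᶠ B} (inl d) = ⇒*-mp Γ (⇒*-const Γ (axiom ipc6 A B ⊤ᶠ)) (deduction d)
deduction {Γ} {A ∨ᶠ B} (inr d) = ⇒*-mp Γ (⇒*-const Γ (axiom ipc7 A B ⊤ᶠ)) (deduction d)
deduction {Γ} {C} (case {A} {B} d e f) =
  ⇒*-mp Γ (⇒*-mp₂ Γ (axiom ipc8 A B C) (deduction e) (deduction f)) (deduction d)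
deduction {Γ} {A} (abort d) = ⇒*-mp Γ (⇒*-const Γ (axiom ipc9 A ⊤ᶠ ⊤ᶠ)) (deduction d)
deduction {Γ} triv = ⇒*-const Γ (ax ipc10)
deduction {Γ} (thm t) = ⇒*-const Γ t

⊢⇒Lmin : ∀ {A} → [] ⊢ A → Lmin A
⊢⇒Lmin = deduction

⊢-weaken : ∀ {Γ Δ A} → Γ ⊆ Δ → Γ ⊢ A → Δ ⊢ A
⊢-weaken s (hyp m) = hyp (s m)
⊢-weaken s (lam d) = lam (⊢-weaken (∷⁺ʳ _ s) d)
⊢-weaken s (app d e) = app (⊢-weaken s d) (⊢-weaken s e)
⊢-weaken s (pair d e) = pair (⊢-weaken s d) (⊢-weaken s e)
⊢-weaken s (fst d) = fst (⊢-weaken s d)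
⊢-weaken s (snd d) = snd (⊢-weaken s d)
⊢-weaken s (inl d) = inl (⊢-weaken s d)
⊢-weaken s (inr d) = inr (⊢-weaken s d)
⊢-weaken s (case d e f) = case (⊢-weaken s d) (⊢-weaken (∷⁺ʳ _ s) e) (⊢-weaken (∷⁺ʳ _ s) f)
⊢-weaken s (abort d) = abort (⊢-weaken s d)
⊢-weaken s triv = triv
⊢-weaken s (thm t) = thm t

-- Kripke semantics and soundness

record Model : Set₁ where
  field
    W       : Set
    _≼_     : W → W → Set
    ≼-refl  : ∀ {x} → x ≼ x
    ≼-trans : ∀ {x y z} → x ≼ y → y ≼ z → x ≼ z
    R       : W → W → Set
    V       : ℕ → W → Set
    V-mono  : ∀ {n x y} → x ≼ y → V n x → V n y

module Semantics (M : Model) where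
  open Model M

  infix 4 _⊨_
  _⊨_ : W → Formula → Set
  x ⊨ atom n = V n x
  x ⊨ A ⇒ B = ∀ y → x ≼ y → y ⊨ A → y ⊨ B
  x ⊨ ⊤ᶠ = ⊤
  x ⊨ ⊥ᶠ = ⊥
  x ⊨ A ∨ᶠ B = x ⊨ A ⊎ x ⊨ B
  x ⊨ A ∧ᶠ B = x ⊨ A × x ⊨ B
  x ⊨ □ A = ∀ y → x ≼ y → ∀ z → R y z → z ⊨ A
  x ⊨ ◇ A = Σ W λ y → y ≼ x × Σ W λ z → R y z × z ⊨ A

  ⊨-mono : ∀ A {x y} → x ≼ y → x ⊨ A → y ⊨ A
  ⊨-mono (atom n) l h = V-mono l h
  ⊨-mono (A ⇒ B) l h = λ y l′ → h y (≼-trans l l′)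
  ⊨-mono ⊤ᶠ l h = tt
  ⊨-mono (A ∨ᶠ B) l (inj₁ a) = inj₁ (⊨-mono A l a)
  ⊨-mono (A ∨ᶠ B) l (inj₂ b) = inj₂ (⊨-mono B l b)
  ⊨-mono (A ∧ᶠ B) l (a , b) = ⊨-mono A l a , ⊨-mono B l b
  ⊨-mono (□ A) l h = λ y l′ → h y (≼-trans l l′)
  ⊨-mono (◇ A) l (y , y≼ , z , r , a) = y , ≼-trans y≼ l , z , r , a

Valid : Formula → Set₁
Valid A = ∀ (M : Model) x → Semantics._⊨_ M x A

_[_]ᴹ : Model → (ℕ → Formula) → Model
M [ σ ]ᴹ = record M { V = λ n x → x ⊨ σ n ; V-mono = λ l → ⊨-mono (σ _) l }
  where open Semantics M

module _ (M : Model) (σ : ℕ → Formula) where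
  open Semantics M
  open Semantics (M [ σ ]ᴹ) renaming (_⊨_ to _⊨σ_)

  ⊨-subst : ∀ A {x} → x ⊨σ A ⇔ x ⊨ A [ σ ]
  ⊨-subst A = mk⇔ (to A) (from A)
    where
    to : ∀ A {x} → x ⊨σ A → x ⊨ A [ σ ]
    from : ∀ A {x} → x ⊨ A [ σ ] → x ⊨σ A
    to (atom n) h = h
    to (A ⇒ B) h = λ y l a → to B (h y l (from A a))
    to ⊤ᶠ h = tt
    to (A ∨ᶠ B) (inj₁ a) = inj₁ (to A a)
    to (A ∨ᶠ B) (inj₂ b) = inj₂ (to B b)
    to (A ∧ᶠ B) (a , b) = to A a , to B b
    to (□ A) h = λ y l z r → to A (h y l z r)
    to (◇ A) (y , l , z , r , a) = y , l , z , r , to A a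
    from (atom n) h = h
    from (A ⇒ B) h = λ y l a → from B (h y l (to A a))
    from ⊤ᶠ h = tt
    from (A ∨ᶠ B) (inj₁ a) = inj₁ (from A a)
    from (A ∨ᶠ B) (inj₂ b) = inj₂ (from B b)
    from (A ∧ᶠ B) (a , b) = from A a , from B b
    from (□ A) h = λ y l z r → from A (h y l z r)
    from (◇ A) (y , l , z , r , a) = y , l , z , r , from A a

module _ (M : Model) where
  open Model M
  open Semantics M

  axiom-valid : ∀ {A} → Axiom A → ∀ x → x ⊨ A
  axiom-valid ipc1 x y _ a z l _ = ⊨-mono p l a
  axiom-valid ipc2 x y _ f z l g w l′ a = f w (≼-trans l l′) a w ≼-refl (g w l′ a)
  axiom-valid ipc3 x y _ (a , _) = a
  axiom-valid ipc4 x y _ (_ , b) = b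
  axiom-valid ipc5 x y _ a z l b = ⊨-mono p l a , b
  axiom-valid ipc6 x y _ = inj₁
  axiom-valid ipc7 x y _ = inj₂
  axiom-valid ipc8 x y _ f z l g w l′ (inj₁ a) = f w (≼-trans l l′) a
  axiom-valid ipc8 x y _ f z l g w l′ (inj₂ b) = g w l′ b
  axiom-valid ipc10 x = tt
  axiom-valid a1 x y _ f z l g w l′ v r = f w (≼-trans l l′) v r v ≼-refl (g w l′ v r)
  axiom-valid a2 x y _ f z l g w l′ v r with f w (≼-trans l l′) v r
  ... | inj₂ b = b
  ... | inj₁ a = g w l′ (w , ≼-refl , v , r , a) w ≼-refl v r
  axiom-valid a3 x y _ (u , u≼ , v , r , inj₁ a) = inj₁ (u , u≼ , v , r , a)
  axiom-valid a3 x y _ (u , u≼ , v , r , inj₂ b) = inj₂ (u , u≼ , v , r , b)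
  axiom-valid a4 x y _ (u , u≼ , v , r , ())

soundness : ∀ {A} → Lmin A → Valid A
soundness (ax a) M = axiom-valid M a
soundness (usub {A} σ d) M x = Equivalence.to (⊨-subst M σ A) (soundness d (M [ σ ]ᴹ) x)
soundness (mp d e) M x = soundness d M x x ≼-refl (soundness e M x) where open Model M
soundness (r1 d) M x y _ z _ = soundness d M z
soundness (r2 d) M x y _ (u , u≼ , v , r , a) = u , u≼ , v , r , soundness d M v v ≼-refl a
  where open Model M
soundness (r3 {A} {B} d) M x y _ (u , u≼ , v , r , a)
  with soundness d M u u (Model.≼-refl M) (u , Model.≼-refl M , v , r , a)
... | inj₁ b = inj₁ (Semantics.⊨-mono M B u≼ b)
... | inj₂ f = inj₂ (u , u≼ , v , r , f u ≼-refl v r v ≼-refl a)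
  where open Model M

infix 4 _==_
_==_ : Formula → Formula → Bool
atom m == atom n = m ≡ᵇ n
(A ⇒ B) == (C ⇒ D) = (A == C) ∧ (B == D)
⊤ᶠ == ⊤ᶠ = true
⊥ᶠ == ⊥ᶠ = true
(A ∨ᶠ B) == (C ∨ᶠ D) = (A == C) ∧ (B == D)
(A ∧ᶠ B) == (C ∧ᶠ D) = (A == C) ∧ (B == D)
□ A == □ C = A == C
◇ A == ◇ C = A == C
_ == _ = false

==⇒≡ : ∀ A B → T (A == B) → A ≡ B
==⇒≡ (atom m) (atom n) e = cong atom (≡ᵇ⇒≡ m n e)
==⇒≡ (A ⇒ B) (C ⇒ D) e with a , b ← Equivalence.to T-∧ e = cong₂ _⇒_ (==⇒≡ A C a) (==⇒≡ B D b)
==⇒≡ ⊤ᶠ ⊤ᶠ _ = refl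
==⇒≡ ⊥ᶠ ⊥ᶠ _ = refl
==⇒≡ (A ∨ᶠ B) (C ∨ᶠ D) e with a , b ← Equivalence.to T-∧ e = cong₂ _∨ᶠ_ (==⇒≡ A C a) (==⇒≡ B D b)
==⇒≡ (A ∧ᶠ B) (C ∧ᶠ D) e with a , b ← Equivalence.to T-∧ e = cong₂ _∧ᶠ_ (==⇒≡ A C a) (==⇒≡ B D b)
==⇒≡ (□ A) (□ C) e = cong □_ (==⇒≡ A C e)
==⇒≡ (◇ A) (◇ C) e = cong ◇_ (==⇒≡ A C e)

==-refl : ∀ A → T (A == A)
==-refl (atom n) = ≡⇒≡ᵇ n n refl
==-refl (A ⇒ B) = Equivalence.from T-∧ (==-refl A , ==-refl B)
==-refl ⊤ᶠ = tt
==-refl ⊥ᶠ = tt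
==-refl (A ∨ᶠ B) = Equivalence.from T-∧ (==-refl A , ==-refl B)
==-refl (A ∧ᶠ B) = Equivalence.from T-∧ (==-refl A , ==-refl B)
==-refl (□ A) = ==-refl A
==-refl (◇ A) = ==-refl A

_≟_ : DecidableEquality Formula
A ≟ B = map′ (==⇒≡ A B) (λ { refl → ==-refl A }) (T? (A == B))

open import Data.List.Membership.DecPropositional _≟_ using (_∈?_; _∉?_)

-- Sequents

⋀ ⋁ : List Formula → Formula
⋀ [] = ⊤ᶠ
⋀ (X ∷ G) = X ∧ᶠ ⋀ G
⋁ [] = ⊥ᶠ
⋁ (X ∷ D) = X ∨ᶠ ⋁ D

⋀-elim : ∀ {Γ G X} → X ∈ G → Γ ⊢ ⋀ G → Γ ⊢ X
⋀-elim (here refl) d = fst d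
⋀-elim (there m) d = ⋀-elim m (snd d)

⋀-intro : ∀ {Γ} G → (∀ {X} → X ∈ G → Γ ⊢ X) → Γ ⊢ ⋀ G
⋀-intro [] f = triv
⋀-intro (X ∷ G) f = pair (f (here refl)) (⋀-intro G (f ∘ there))

⋁-intro : ∀ {Γ D X} → X ∈ D → Γ ⊢ X → Γ ⊢ ⋁ D
⋁-intro (here refl) d = inl d
⋁-intro (there m) d = inr (⋁-intro m d)

⋁-elim : ∀ {Γ C} D → Γ ⊢ ⋁ D → (∀ {X} → X ∈ D → X ∷ Γ ⊢ C) → Γ ⊢ C
⋁-elim [] d f = abort d
⋁-elim (X ∷ D) d f = case d (f (here refl)) (⋁-elim D v₀ (⊢-weaken (∷⁺ʳ _ there) ∘ f ∘ there))

⋀-⊆ : ∀ {Γ G H} → G ⊆ H → Γ ⊢ ⋀ H → Γ ⊢ ⋀ G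
⋀-⊆ {G = G} s d = ⋀-intro G (λ m → ⋀-elim (s m) d)

⋁-⊆ : ∀ {Γ D E} → D ⊆ E → Γ ⊢ ⋁ D → Γ ⊢ ⋁ E
⋁-⊆ {D = D} s d = ⋁-elim D d (λ m → ⋁-intro (s m) v₀)

infix 3 _⇛_
_⇛_ : List Formula → List Formula → Set
G ⇛ D = Lmin (⋀ G ⇒ ⋁ D)

⇛-intro : ∀ {G D} → ⋀ G ∷ [] ⊢ ⋁ D → G ⇛ D
⇛-intro d = ⊢⇒Lmin (lam d)

⇛-elim : ∀ {Γ G D} → G ⇛ D → Γ ⊢ ⋀ G → Γ ⊢ ⋁ D
⇛-elim s d = app (thm s) d

⇛-weaken : ∀ {G D G′ D′} → G ⊆ G′ → D ⊆ D′ → G ⇛ D → G′ ⇛ D′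
⇛-weaken sg sd s = ⇛-intro (⋁-⊆ sd (⇛-elim s (⋀-⊆ sg v₀)))

⇛-axiom : ∀ {G D X} → X ∈ G → X ∈ D → G ⇛ D
⇛-axiom mg md = ⇛-intro (⋁-intro md (⋀-elim mg v₀))

⇛-cut : ∀ {G D X} → X ∷ G ⇛ D → G ⇛ X ∷ D → G ⇛ D
⇛-cut s t = ⇛-intro (case (⇛-elim t v₀) (⇛-elim s (pair v₀ v₁)) v₀)

infixl 6 _∩_ _∖_ _-_
_∩_ _∖_ _-_ : List Formula → List Formula → List Formula
L ∩ z = filter (_∈? z) L
L ∖ z = filter (_∉? z) L
z - L = filter (_∉? L) z

module _ {F : Formula} {L z : List Formula} where
  ∩-insert : (F ∷ L) ∩ (F ∷ z) ⊆ F ∷ L ∩ z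
  ∩-insert m with ∈-filter⁻ (_∈? F ∷ z) {xs = F ∷ L} m
  ... | here refl , _ = here refl
  ... | there _ , here refl = here refl
  ... | there mL , there mz = there (∈-filter⁺ (_∈? z) mL mz)

  ∖-insert : (F ∷ L) ∖ (F ∷ z) ⊆ L ∖ z
  ∖-insert m with ∈-filter⁻ (_∉? F ∷ z) {xs = F ∷ L} m
  ... | here refl , F∉ = ⊥-elim (F∉ (here refl))
  ... | there mL , X∉ = ∈-filter⁺ (_∉? z) mL (X∉ ∘ there)

  ∩-remove : (F ∷ L) ∩ (z - (F ∷ [])) ⊆ L ∩ z
  ∩-remove m with ∈-filter⁻ (_∈? z - (F ∷ [])) {xs = F ∷ L} m
  ... | mFL , m- with ∈-filter⁻ (_∉? (F ∷ [])) {xs = z} m- | mFL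
  ...   | _ , F∉ | here refl = ⊥-elim (F∉ (here refl))
  ...   | mz , _ | there mL = ∈-filter⁺ (_∈? z) mL mz

  ∖-remove : (F ∷ L) ∖ (z - (F ∷ [])) ⊆ F ∷ L ∖ z
  ∖-remove {X} m with ∈-filter⁻ (_∉? z - (F ∷ [])) {xs = F ∷ L} m
  ... | here refl , _ = here refl
  ... | there mL , X∉ with X ≟ F
  ...   | yes refl = here refl
  ...   | no X≢F = there (∈-filter⁺ (_∉? z) mL (X∉ ∘ λ mz → ∈-filter⁺ (_∉? (F ∷ [])) mz λ { (here e) → X≢F e }))

⇛-cut-all : ∀ L {G D} → (∀ z → G ++ L ∩ z ⇛ D ++ L ∖ z) → G ⇛ D
⇛-cut-all [] {G} {D} h = ⇛-weaken (⊆-reflexive (++-identityʳ G)) (⊆-reflexive (++-identityʳ D)) (h [])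
⇛-cut-all (F ∷ L) {G} {D} h = ⇛-cut F-left F-right
  where
  F-left : F ∷ G ⇛ D
  F-left = ⇛-cut-all L λ z → ⇛-weaken
    (⊆-trans (++⁺ʳ G (∩-insert {F} {L} {z})) (⊆-reflexive-↭ (shift F G (L ∩ z))))
    (++⁺ʳ D (∖-insert {F} {L} {z}))
    (h (F ∷ z))
  F-right : G ⇛ F ∷ D
  F-right = ⇛-cut-all L λ z → ⇛-weaken
    (++⁺ʳ G (∩-remove {F} {L} {z}))
    (⊆-trans (++⁺ʳ D (∖-remove {F} {L} {z})) (⊆-reflexive-↭ (shift F D (L ∖ z))))
    (h (z - (F ∷ [])))

□-mono : ∀ {X Y} → Lmin (X ⇒ Y) → Lmin (□ X ⇒ □ Y)
□-mono {X} {Y} t = mp (axiom a1 X Y ⊤ᶠ) (r1 t)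

□-⋀-rule : ∀ G {B} → Lmin (⋀ G ⇒ B) → Lmin (⋀ (map □_ G) ⇒ □ B)
□-⋀-rule [] t = ⊢⇒Lmin (lam (thm (r1 (⊢⇒Lmin (app (thm t) triv)))))
□-⋀-rule (X ∷ G) {B} t = ⊢⇒Lmin (lam (app (app (thm (axiom a1 X B ⊤ᶠ)) (app (thm curried) (snd v₀))) (fst v₀)))
  where
  curried : Lmin (⋀ (map □_ G) ⇒ □ (X ⇒ B))
  curried = □-⋀-rule G (⊢⇒Lmin (lam (lam (app (thm t) (pair v₀ v₁)))))

◇-⋁ : ∀ D → Lmin (◇ (⋁ D) ⇒ ⋁ (map ◇_ D))
◇-⋁ [] = ax a4
◇-⋁ (X ∷ D) = ⊢⇒Lmin (lam (case (app (thm (axiom a3 X (⋁ D) ⊤ᶠ)) v₀) (inl v₀) (inr (app (thm (◇-⋁ D)) v₀))))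

◇-⋁-elim : ∀ {Γ C} D → Γ ⊢ ◇ (⋁ D) → (∀ {X} → X ∈ D → ◇ X ∷ Γ ⊢ C) → Γ ⊢ C
◇-⋁-elim D d f = ⋁-elim (map ◇_ D) (app (thm (◇-⋁ D)) d) λ m → case′ (∈-map⁻ ◇_ m)
  where
  case′ : ∀ {Y} → ∃ (λ X → X ∈ D × Y ≡ ◇ X) → Y ∷ _ ⊢ _
  case′ (_ , m , refl) = f m

⋁-single : ∀ {Γ X} → Γ ⊢ ⋁ (X ∷ []) → Γ ⊢ X
⋁-single d = case d v₀ (abort v₀)

□-rule : ∀ {Gb Dd H B} → Gb ⇛ B ∷ Dd → (∀ {D} → D ∈ Dd → ◇ D ∷ H ⇛ □ B ∷ []) → map □_ Gb ⊆ H
       → H ⇛ □ B ∷ []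
□-rule {Gb} {Dd} {H} {B} s sD hb = ⇛-intro (inl (app (app (thm (axiom a2 (⋁ Dd) B ⊤ᶠ)) boxed) (lam ◇Dd⇒□B)))
  where
  boxed : ⋀ H ∷ [] ⊢ □ (⋁ Dd ∨ᶠ B)
  boxed = app (thm (□-⋀-rule Gb (⊢⇒Lmin (lam (case (⇛-elim s v₀) (inr v₀) (inl v₀)))))) (⋀-⊆ hb v₀)
  ◇Dd⇒□B : ◇ (⋁ Dd) ∷ ⋀ H ∷ [] ⊢ □ B
  ◇Dd⇒□B = ◇-⋁-elim Dd v₀ (λ m → ⋁-single (⇛-elim (sD m) (pair v₀ (hyp (there (there (here refl)))))))

□⇒-rule : ∀ {A Gb Dd H} → A ∷ Gb ⇛ Dd → map □_ Gb ⊆ H → Lmin (⋀ H ⇒ □ (A ⇒ ⋁ Dd))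
□⇒-rule {Gb = Gb} s hb =
  ⊢⇒Lmin (lam (app (thm (□-⋀-rule Gb (⊢⇒Lmin (lam (lam (⇛-elim s (pair v₀ v₁))))))) (⋀-⊆ hb v₀)))

◇-rule : ∀ {A Dd D₀} → ◇ A ∷ [] ⇛ □ (A ⇒ ⋁ Dd) ∷ D₀ → map ◇_ Dd ⊆ D₀ → Lmin (◇ A ⇒ ⋁ D₀)
◇-rule {A} {Dd} {D₀} s hd = ⊢⇒Lmin (lam (case (app (thm (r3 split)) v₀) v₀ (⋁-⊆ hd (app (thm (◇-⋁ Dd)) v₀))))
  where
  split : Lmin (◇ A ⇒ ⋁ D₀ ∨ᶠ □ (A ⇒ ⋁ Dd))
  split = ⊢⇒Lmin (lam (case (⇛-elim s (pair v₀ triv)) (inr v₀) (inl v₀)))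

□⇒⋁-mono : ∀ {A D E} → D ⊆ E → Lmin (□ (A ⇒ ⋁ D) ⇒ □ (A ⇒ ⋁ E))
□⇒⋁-mono s = □-mono (⊢⇒Lmin (lam (lam (⋁-⊆ s (app v₁ v₀)))))

□⁻¹ ◇⁻¹ : Formula → List Formula
□⁻¹ (□ C) = C ∷ []
□⁻¹ _ = []
◇⁻¹ (◇ C) = C ∷ []
◇⁻¹ _ = []

unbox undia : List Formula → List Formula
unbox = concatMap □⁻¹
undia = concatMap ◇⁻¹

module _ {C : Formula} {L : List Formula} where
  ∈-unbox⁺ : □ C ∈ L → C ∈ unbox L
  ∈-unbox⁺ m = ∈-concatMap⁺ □⁻¹ (Any.map (λ { refl → here refl }) m)

  ∈-unbox⁻ : C ∈ unbox L → □ C ∈ L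
  ∈-unbox⁻ m = Any.map (λ { {□ _} (here refl) → refl }) (∈-concatMap⁻ □⁻¹ m)

  ∈-undia⁺ : ◇ C ∈ L → C ∈ undia L
  ∈-undia⁺ m = ∈-concatMap⁺ ◇⁻¹ (Any.map (λ { refl → here refl }) m)

  ∈-undia⁻ : C ∈ undia L → ◇ C ∈ L
  ∈-undia⁻ m = Any.map (λ { {◇ _} (here refl) → refl }) (∈-concatMap⁻ ◇⁻¹ m)

map-□-unbox : ∀ L → map □_ (unbox L) ⊆ L
map-□-unbox L m with ∈-map⁻ □_ m
... | _ , mC , refl = ∈-unbox⁻ mC

map-◇-undia : ∀ L → map ◇_ (undia L) ⊆ L
map-◇-undia L m with ∈-map⁻ ◇_ m
... | _ , mC , refl = ∈-undia⁻ mC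

ChildrenIn : List Formula → Formula → Set
ChildrenIn S (A ⇒ B) = A ∈ S × B ∈ S
ChildrenIn S (A ∨ᶠ B) = A ∈ S × B ∈ S
ChildrenIn S (A ∧ᶠ B) = A ∈ S × B ∈ S
ChildrenIn S (□ A) = A ∈ S
ChildrenIn S (◇ A) = A ∈ S
ChildrenIn S _ = ⊤

SubformulaClosed : List Formula → Set
SubformulaClosed S = ∀ {F} → F ∈ S → ChildrenIn S F

subformulas proper : Formula → List Formula
subformulas F = F ∷ proper F
proper (A ⇒ B) = subformulas A ++ subformulas B
proper (A ∨ᶠ B) = subformulas A ++ subformulas B
proper (A ∧ᶠ B) = subformulas A ++ subformulas B
proper (□ A) = subformulas A
proper (◇ A) = subformulas A
proper _ = []

subformulas-trans : ∀ G {F} → F ∈ subformulas G → subformulas F ⊆ subformulas G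
proper-trans : ∀ G {F} → F ∈ proper G → subformulas F ⊆ proper G
++-trans : ∀ A B {F} → F ∈ subformulas A ++ subformulas B → subformulas F ⊆ subformulas A ++ subformulas B

subformulas-trans G (here refl) = λ m → m
subformulas-trans G (there m) = there ∘ proper-trans G m
proper-trans (A ⇒ B) = ++-trans A B
proper-trans (A ∨ᶠ B) = ++-trans A B
proper-trans (A ∧ᶠ B) = ++-trans A B
proper-trans (□ A) = subformulas-trans A
proper-trans (◇ A) = subformulas-trans A
++-trans A B m with ∈-++⁻ (subformulas A) m
... | inj₁ a = λ n → ∈-++⁺ˡ (subformulas-trans A a n)
... | inj₂ b = λ n → ∈-++⁺ʳ (subformulas A) (subformulas-trans B b n)

children-in-subformulas : ∀ F → ChildrenIn (subformulas F) F
children-in-subformulas (A ⇒ B) = there (here refl) , there (∈-++⁺ʳ (subformulas A) (here refl))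
children-in-subformulas (A ∨ᶠ B) = there (here refl) , there (∈-++⁺ʳ (subformulas A) (here refl))
children-in-subformulas (A ∧ᶠ B) = there (here refl) , there (∈-++⁺ʳ (subformulas A) (here refl))
children-in-subformulas (□ A) = there (here refl)
children-in-subformulas (◇ A) = there (here refl)
children-in-subformulas (atom _) = tt
children-in-subformulas ⊤ᶠ = tt
children-in-subformulas ⊥ᶠ = tt

ChildrenIn-mono : ∀ {S S′} F → S ⊆ S′ → ChildrenIn S F → ChildrenIn S′ F
ChildrenIn-mono (A ⇒ B) s (a , b) = s a , s b
ChildrenIn-mono (A ∨ᶠ B) s (a , b) = s a , s b
ChildrenIn-mono (A ∧ᶠ B) s (a , b) = s a , s b
ChildrenIn-mono (□ A) s a = s a
ChildrenIn-mono (◇ A) s a = s a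
ChildrenIn-mono (atom _) _ _ = tt
ChildrenIn-mono ⊤ᶠ _ _ = tt
ChildrenIn-mono ⊥ᶠ _ _ = tt

subformulas-closed : ∀ G → SubformulaClosed (subformulas G)
subformulas-closed G {F} m = ChildrenIn-mono F (subformulas-trans G m) (children-in-subformulas F)

-- Elimination of worlds

module Worlds (S : List Formula) (closed : SubformulaClosed S) where

  -- A world is a set of formulas; only its trace on S matters.
  World : Set
  World = List Formula

  infix 10 _⁺ _⁻
  _⁺ _⁻ : World → List Formula
  w ⁺ = S ∩ w
  w ⁻ = S ∖ w

  module _ {F : Formula} {w : World} where
    ⁺-intro : F ∈ S → F ∈ w → F ∈ w ⁺
    ⁺-intro = ∈-filter⁺ (_∈? w)
    ⁻-intro : F ∈ S → F ∉ w → F ∈ w ⁻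
    ⁻-intro = ∈-filter⁺ (_∉? w)
    ⁺-elim : F ∈ w ⁺ → F ∈ S × F ∈ w
    ⁺-elim = ∈-filter⁻ (_∈? w)
    ⁻-elim : F ∈ w ⁻ → F ∈ S × F ∉ w
    ⁻-elim = ∈-filter⁻ (_∉? w)

  Inconsistent : World → Set
  Inconsistent w = w ⁺ ⇛ w ⁻

  infix 4 _⊑_ _≈_
  _⊑_ _≈_ : World → World → Set
  w ⊑ v = ∀ {F} → F ∈ S → F ∈ w → F ∈ v
  w ≈ v = w ⊑ v × v ⊑ w

  ⊑-refl : ∀ {w} → w ⊑ w
  ⊑-refl _ m = m

  ⊑-trans : ∀ {u v w} → u ⊑ v → v ⊑ w → u ⊑ w
  ⊑-trans a b s = b s ∘ a s

  ⊑-or-witness : ∀ w v → w ⊑ v ⊎ ∃ λ F → F ∈ S × F ∈ w × F ∉ v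
  ⊑-or-witness w v with all? (_∈? v) (w ⁺)
  ... | yes a = inj₁ λ s m → All.lookup a (⁺-intro s m)
  ... | no ¬a with find (¬All⇒Any¬ (_∈? v) (w ⁺) ¬a)
  ...   | F , m , F∉v = inj₂ (F , proj₁ (⁺-elim m) , proj₂ (⁺-elim m) , F∉v)

  _⊑?_ : ∀ w v → Dec (w ⊑ v)
  w ⊑? v with ⊑-or-witness w v
  ... | inj₁ a = yes a
  ... | inj₂ (F , s , m , F∉v) = no λ f → F∉v (f s m)

  _≈?_ : ∀ w v → Dec (w ≈ v)
  w ≈? v = (w ⊑? v) ×-dec (v ⊑? w)

  Inconsistent-resp-≈ : ∀ {w v} → w ≈ v → Inconsistent w → Inconsistent v
  Inconsistent-resp-≈ (w⊑v , v⊑w) = ⇛-weaken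
    (λ m → let s , a = ⁺-elim m in ⁺-intro s (w⊑v s a))
    (λ m → let s , a = ⁻-elim m in ⁻-intro s (a ∘ v⊑w s))

  Accessible : World → World → Set
  Accessible y z = (∀ {C} → □ C ∈ S → □ C ∈ y → C ∈ z) × (∀ {D} → ◇ D ∈ S → D ∈ z → ◇ D ∈ y)

  Violation : World → World → Set
  Violation y z = (∃ λ C → C ∈ unbox (y ⁺) × C ∉ z) ⊎ (∃ λ D → D ∈ undia (y ⁻) × D ∈ z)

  accessible-or-violation : ∀ y z → Accessible y z ⊎ Violation y z
  accessible-or-violation y z with all? (_∈? z) (unbox (y ⁺)) | all? (_∉? z) (undia (y ⁻))
  ... | no ¬a | _ = inj₂ (inj₁ (find (¬All⇒Any¬ (_∈? z) _ ¬a)))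
  ... | yes _ | no ¬b with find (¬All⇒Any¬ (_∉? z) _ ¬b)
  ...   | D , m , ¬D∉z = inj₂ (inj₂ (D , m , decidable-stable (D ∈? z) ¬D∉z))
  accessible-or-violation y z | yes a | yes b = inj₁ (boxes , diamonds)
    where
    boxes : ∀ {C} → □ C ∈ S → □ C ∈ y → C ∈ z
    boxes s m = All.lookup a (∈-unbox⁺ (⁺-intro s m))
    diamonds : ∀ {D} → ◇ D ∈ S → D ∈ z → ◇ D ∈ y
    diamonds {D} s m with ◇ D ∈? y
    ... | yes n = n
    ... | no n = ⊥-elim (All.lookup b (∈-undia⁺ (⁻-intro s n)) m)

  Accessible? : ∀ y z → Dec (Accessible y z)
  Accessible? y z with accessible-or-violation y z
  ... | inj₁ r = yes r
  ... | inj₂ (inj₁ (C , m , C∉z)) = no λ r → let s , □C∈y = ⁺-elim (∈-unbox⁻ m) in C∉z (proj₁ r s □C∈y)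
  ... | inj₂ (inj₂ (D , m , D∈z)) = no λ r → let s , ◇D∉y = ⁻-elim (∈-undia⁻ m) in ◇D∉y (proj₂ r s D∈z)

  Accessible-resp-≈ : ∀ {y z z′} → Accessible y z → z ≈ z′ → Accessible y z′
  Accessible-resp-≈ (boxes , diamonds) (z⊑z′ , z′⊑z) =
    (λ s m → z⊑z′ (closed s) (boxes s m)) , (λ s m → diamonds s (z′⊑z (closed s) m))

  _∈≈_ : World → List World → Set
  z ∈≈ Ws = ∃ λ w → w ∈ Ws × w ≈ z

  AllConsistentIn : List World → Set
  AllConsistentIn Ws = ∀ z → ¬ z ∈≈ Ws → Inconsistent z

  Local : World → Formula → Set
  Local w ⊤ᶠ = ⊤ᶠ ∈ w
  Local w ⊥ᶠ = ⊥ᶠ ∉ w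
  Local w (B ∧ᶠ C) = (B ∧ᶠ C ∈ w → B ∈ w × C ∈ w) × (B ∈ w → C ∈ w → B ∧ᶠ C ∈ w)
  Local w (B ∨ᶠ C) = (B ∨ᶠ C ∈ w → B ∈ w ⊎ C ∈ w) × (B ∈ w → B ∨ᶠ C ∈ w) × (C ∈ w → B ∨ᶠ C ∈ w)
  Local w (B ⇒ C) = B ⇒ C ∈ w → B ∈ w → C ∈ w
  Local w _ = ⊤

  -- Each demand mirrors a Kripke clause that could fail at w and asks for a witness among Ws.
  Realised : List World → World → Formula → Set
  Realised Ws w (B ⇒ C) = B ⇒ C ∈ w ⊎ ∃ λ y → y ∈ Ws × w ⊑ y × B ∈ y × C ∉ y
  Realised Ws w (□ B) = □ B ∈ w ⊎ ∃ λ y → y ∈ Ws × w ⊑ y × ∃ λ z → z ∈ Ws × Accessible y z × B ∉ z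
  Realised Ws w (◇ A) = ◇ A ∉ w ⊎ ∃ λ y → y ∈ Ws × y ⊑ w × ∃ λ z → z ∈ Ws × Accessible y z × A ∈ z
  Realised Ws w _ = ⊤

  record Saturated (Ws : List World) (w : World) : Set where
    field
      local    : ∀ {F} → F ∈ S → Local w F
      realised : ∀ {F} → F ∈ S → Realised Ws w F

  module _ {w : World} where
    ⊢-true : ∀ {F} → F ∈ S → F ∈ w → ⋀ (w ⁺) ∷ [] ⊢ F
    ⊢-true s m = ⋀-elim (⁺-intro s m) v₀

    ⊢-false : ∀ {Γ F} → F ∈ S → F ∉ w → Γ ⊢ F → Γ ⊢ ⋁ (w ⁻)
    ⊢-false s F∉w = ⋁-intro (⁻-intro s F∉w)

    local-∧-or-inconsistent : ∀ {B C} → B ∧ᶠ C ∈ S → Local w (B ∧ᶠ C) ⊎ Inconsistent w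
    local-∧-or-inconsistent {B} {C} s with closed s | B ∧ᶠ C ∈? w | B ∈? w | C ∈? w
    ... | _ | yes a | yes b | yes c = inj₁ ((λ _ → b , c) , λ _ _ → a)
    ... | bS , _ | yes a | no b | _ = inj₂ (⇛-intro (⊢-false bS b (fst (⊢-true s a))))
    ... | _ , cS | yes a | _ | no c = inj₂ (⇛-intro (⊢-false cS c (snd (⊢-true s a))))
    ... | bS , cS | no a | yes b | yes c = inj₂ (⇛-intro (⊢-false s a (pair (⊢-true bS b) (⊢-true cS c))))
    ... | _ | no a | no b | _ = inj₁ ((λ m → ⊥-elim (a m)) , λ m _ → ⊥-elim (b m))
    ... | _ | no a | _ | no c = inj₁ ((λ m → ⊥-elim (a m)) , λ _ m → ⊥-elim (c m))

    local-∨-or-inconsistent : ∀ {B C} → B ∨ᶠ C ∈ S → Local w (B ∨ᶠ C) ⊎ Inconsistent w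
    local-∨-or-inconsistent {B} {C} s with closed s | B ∨ᶠ C ∈? w | B ∈? w | C ∈? w
    ... | _ | yes a | yes b | _ = inj₁ ((λ _ → inj₁ b) , (λ _ → a) , λ _ → a)
    ... | _ | yes a | no _ | yes c = inj₁ ((λ _ → inj₂ c) , (λ _ → a) , λ _ → a)
    ... | bS , cS | yes a | no b | no c =
      inj₂ (⇛-intro (case (⊢-true s a) (⊢-false bS b v₀) (⊢-false cS c v₀)))
    ... | bS , _ | no a | yes b | _ = inj₂ (⇛-intro (⊢-false s a (inl (⊢-true bS b))))
    ... | _ , cS | no a | no _ | yes c = inj₂ (⇛-intro (⊢-false s a (inr (⊢-true cS c))))
    ... | _ | no a | no b | no c = inj₁ ((λ m → ⊥-elim (a m)) , (λ m → ⊥-elim (b m)) , λ m → ⊥-elim (c m))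

    local-⇒-or-inconsistent : ∀ {B C} → B ⇒ C ∈ S → Local w (B ⇒ C) ⊎ Inconsistent w
    local-⇒-or-inconsistent {B} {C} s with closed s | B ⇒ C ∈? w | B ∈? w | C ∈? w
    ... | bS , cS | yes a | yes b | no c = inj₂ (⇛-intro (⊢-false cS c (app (⊢-true s a) (⊢-true bS b))))
    ... | _ | yes _ | yes _ | yes c = inj₁ λ _ _ → c
    ... | _ | yes _ | no b | _ = inj₁ λ _ m → ⊥-elim (b m)
    ... | _ | no a | _ | _ = inj₁ λ m → ⊥-elim (a m)

  local-or-inconsistent : ∀ w {F} → F ∈ S → Local w F ⊎ Inconsistent w
  local-or-inconsistent w {⊤ᶠ} s with ⊤ᶠ ∈? w
  ... | yes m = inj₁ m
  ... | no ⊤∉w = inj₂ (⇛-intro (⊢-false s ⊤∉w triv))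
  local-or-inconsistent w {⊥ᶠ} s with ⊥ᶠ ∈? w
  ... | yes m = inj₂ (⇛-intro (abort (⊢-true s m)))
  ... | no ⊥∉w = inj₁ ⊥∉w
  local-or-inconsistent w {_ ∧ᶠ _} = local-∧-or-inconsistent
  local-or-inconsistent w {_ ∨ᶠ _} = local-∨-or-inconsistent
  local-or-inconsistent w {_ ⇒ _} = local-⇒-or-inconsistent
  local-or-inconsistent w {atom _} _ = inj₁ tt
  local-or-inconsistent w {□ _} _ = inj₁ tt
  local-or-inconsistent w {◇ _} _ = inj₁ tt

  module _ {w v : World} (w⊑v : w ⊑ v) where
    ⁺-mono : w ⁺ ⊆ v ⁺
    ⁺-mono m = let s , a = ⁺-elim m in ⁺-intro s (w⊑v s a)

    ⁻-antitone : v ⁻ ⊆ w ⁻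
    ⁻-antitone m = let s , a = ⁻-elim m in ⁻-intro s (a ∘ w⊑v s)

    length⁻-mono : length (v ⁻) ≤ length (w ⁻)
    length⁻-mono = length-filter-mono (_∉? v) (_∉? w) S λ s F∉v F∈w → F∉v (w⊑v s F∈w)

    module _ {F : Formula} (s : F ∈ S) (F∈v : F ∈ v) (F∉w : F ∉ w) where
      length⁻-< : length (v ⁻) < length (w ⁻)
      length⁻-< = length-filter-mono-< (_∉? v) (_∉? w) S (λ s F∉v F∈w → F∉v (w⊑v s F∈w)) s F∉w (λ F∉v → F∉v F∈v)

      length⁺-< : length (w ⁺) < length (v ⁺)
      length⁺-< = length-filter-mono-< (_∈? w) (_∈? v) S w⊑v s F∈v F∉w

  unbox⁺⊆S : ∀ {y C} → C ∈ unbox (y ⁺) → C ∈ S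
  unbox⁺⊆S m = closed (proj₁ (⁺-elim (∈-unbox⁻ m)))

  undia⁻⊆S : ∀ {y D} → D ∈ undia (y ⁻) → D ∈ S
  undia⁻⊆S m = closed (proj₁ (⁻-elim (∈-undia⁻ m)))

  violation-axiom : ∀ {y z G D} → Violation y z → unbox (y ⁺) ⊆ G → undia (y ⁻) ⊆ D
                  → G ++ z ⁺ ⇛ D ++ z ⁻
  violation-axiom {G = G} (inj₁ (C , m , C∉z)) ⊆G _ =
    ⇛-axiom (∈-++⁺ˡ (⊆G m)) (∈-++⁺ʳ _ (⁻-intro (unbox⁺⊆S m) C∉z))
  violation-axiom {G = G} (inj₂ (D , m , D∈z)) _ ⊆D =
    ⇛-axiom (∈-++⁺ʳ G (⁺-intro (undia⁻⊆S m) D∈z)) (∈-++⁺ˡ (⊆D m))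

  module EliminationStep (Ws : List World) (complete : AllConsistentIn Ws) where

    ⇒-inconsistent : ∀ {w B C} → B ⇒ C ∈ S → B ⇒ C ∉ w → ¬ (∃ λ y → y ∈ Ws × w ⊑ y × B ∈ y × C ∉ y)
                   → Inconsistent w
    ⇒-inconsistent {w} {B} {C} s B⇒C∉w unrealised =
      ⇛-intro (⊢-false s B⇒C∉w (lam (⋁-single (⇛-elim (⇛-cut-all S by-cases) (pair v₀ v₁)))))
      where
      bS : B ∈ S
      bS = proj₁ (closed s)
      cS : C ∈ S
      cS = proj₂ (closed s)
      by-cases : ∀ z → B ∷ w ⁺ ++ z ⁺ ⇛ C ∷ z ⁻
      by-cases z with B ∈? z | C ∈? z | ⊑-or-witness w z
      ... | no B∉z | _ | _ = ⇛-axiom (here refl) (there (⁻-intro bS B∉z))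
      ... | yes _ | yes C∈z | _ = ⇛-axiom (there (∈-++⁺ʳ (w ⁺) (⁺-intro cS C∈z))) (here refl)
      ... | yes _ | no _ | inj₂ (F , fS , F∈w , F∉z) =
        ⇛-axiom (there (∈-++⁺ˡ (⁺-intro fS F∈w))) (there (⁻-intro fS F∉z))
      ... | yes B∈z | no C∉z | inj₁ w⊑z = ⇛-weaken (there ∘ ∈-++⁺ʳ (w ⁺)) there
        (complete z λ (y , yW , y⊑z , z⊑y) → unrealised (y , yW , ⊑-trans w⊑z z⊑y , z⊑y bS B∈z , C∉z ∘ y⊑z cS))

    module □-Demand {w B} (s : □ B ∈ S)
      (unrealised : ¬ (∃ λ y → y ∈ Ws × w ⊑ y × ∃ λ z → z ∈ Ws × Accessible y z × B ∉ z)) where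

      bS : B ∈ S
      bS = closed s

      boxed-premise : ∀ {y} → y ∈ Ws → w ⊑ y → unbox (y ⁺) ⇛ B ∷ undia (y ⁻)
      boxed-premise {y} yW w⊑y = ⇛-cut-all S by-cases
        where
        by-cases : ∀ z → unbox (y ⁺) ++ z ⁺ ⇛ B ∷ undia (y ⁻) ++ z ⁻
        by-cases z with B ∈? z | accessible-or-violation y z
        ... | yes B∈z | _ = ⇛-axiom (∈-++⁺ʳ _ (⁺-intro bS B∈z)) (here refl)
        ... | no _ | inj₂ viol = violation-axiom viol (λ m → m) there
        ... | no B∉z | inj₁ r = ⇛-weaken (∈-++⁺ʳ _) (there ∘ ∈-++⁺ʳ _)
          (complete z λ (z′ , zW , z′≈z) →
            unrealised (y , yW , w⊑y , z′ , zW , Accessible-resp-≈ r (swap z′≈z) , B∉z ∘ proj₁ z′≈z bS))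

      □-inconsistent : ∀ x → Acc _<_ (length (x ⁻)) → w ⊑ x → □ B ∉ x → Inconsistent x
      □-inconsistent x (acc smaller) w⊑x □B∉x with search (_≈? x) Ws
      ... | no ¬∃ = complete x ¬∃
      ... | yes (y , yW , y≈x@(y⊑x , x⊑y)) = Inconsistent-resp-≈ y≈x y-inconsistent
        where
        diamond-premise : ∀ {D} → D ∈ undia (y ⁻) → ◇ D ∷ y ⁺ ⇛ □ B ∷ []
        diamond-premise {D} mD = ⇛-cut-all S by-cases
          where
          dS : ◇ D ∈ S
          dS = proj₁ (⁻-elim (∈-undia⁻ mD))
          ◇D∉y : ◇ D ∉ y
          ◇D∉y = proj₂ (⁻-elim (∈-undia⁻ mD))
          by-cases : ∀ z → ◇ D ∷ y ⁺ ++ z ⁺ ⇛ □ B ∷ z ⁻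
          by-cases z with □ B ∈? z | ◇ D ∈? z | ⊑-or-witness y z
          ... | yes □B∈z | _ | _ = ⇛-axiom (there (∈-++⁺ʳ (y ⁺) (⁺-intro s □B∈z))) (here refl)
          ... | no _ | no ◇D∉z | _ = ⇛-axiom (here refl) (there (⁻-intro dS ◇D∉z))
          ... | no _ | yes _ | inj₂ (F , fS , F∈y , F∉z) =
            ⇛-axiom (there (∈-++⁺ˡ (⁺-intro fS F∈y))) (there (⁻-intro fS F∉z))
          ... | no □B∉z | yes ◇D∈z | inj₁ y⊑z = ⇛-weaken (there ∘ ∈-++⁺ʳ (y ⁺)) there
            (□-inconsistent z (smaller (<-≤-trans (length⁻-< y⊑z dS ◇D∈z ◇D∉y) (length⁻-mono x⊑y)))
              (⊑-trans w⊑x (⊑-trans x⊑y y⊑z)) □B∉z)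
        y-inconsistent : Inconsistent y
        y-inconsistent = ⇛-weaken (λ m → m) (λ { (here refl) → ⁻-intro s (□B∉x ∘ y⊑x s) })
          (□-rule (boxed-premise yW (⊑-trans w⊑x x⊑y)) diamond-premise (map-□-unbox (y ⁺)))

    module ◇-Demand {w A} (s : ◇ A ∈ S)
      (unrealised : ¬ (∃ λ y → y ∈ Ws × y ⊑ w × ∃ λ z → z ∈ Ws × Accessible y z × A ∈ z)) where

      aS : A ∈ S
      aS = closed s

      □⇒-premise : ∀ {v} → v ∈ Ws → v ⊑ w → A ∷ unbox (v ⁺) ⇛ undia (v ⁻)
      □⇒-premise {v} vW v⊑w = ⇛-cut-all S by-cases
        where
        by-cases : ∀ z → A ∷ unbox (v ⁺) ++ z ⁺ ⇛ undia (v ⁻) ++ z ⁻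
        by-cases z with A ∈? z | accessible-or-violation v z
        ... | no A∉z | _ = ⇛-axiom (here refl) (∈-++⁺ʳ _ (⁻-intro aS A∉z))
        ... | yes _ | inj₂ viol = violation-axiom viol there (λ m → m)
        ... | yes A∈z | inj₁ r = ⇛-weaken (there ∘ ∈-++⁺ʳ _) (∈-++⁺ʳ _)
          (complete z λ (z′ , zW , z′≈z) →
            unrealised (v , vW , v⊑w , z′ , zW , Accessible-resp-≈ r (swap z′≈z) , proj₂ z′≈z aS A∈z))

      ◇-inconsistent : ∀ x → Acc _<_ (length (x ⁺)) → x ⊑ w → ◇ A ∈ x → Inconsistent x
      ◇-inconsistent x (acc smaller) x⊑w ◇A∈x =
        ⇛-intro (app (thm (◇-rule (⇛-cut-all S by-cases) (map-◇-undia (x ⁻)))) (⊢-true s ◇A∈x))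
        where
        -- Via R3 only the worlds y ≈ x remain, and they derive E from a representative in Ws.
        E : Formula
        E = □ (A ⇒ ⋁ (undia (x ⁻)))
        by-cases : ∀ y → ◇ A ∷ y ⁺ ⇛ E ∷ x ⁻ ++ y ⁻
        by-cases y with ◇ A ∈? y | ⊑-or-witness y x
        ... | no ◇A∉y | _ = ⇛-axiom (here refl) (there (∈-++⁺ʳ (x ⁻) (⁻-intro s ◇A∉y)))
        ... | yes _ | inj₂ (F , fS , F∈y , F∉x) = ⇛-axiom (there (⁺-intro fS F∈y)) (there (∈-++⁺ˡ (⁻-intro fS F∉x)))
        ... | yes ◇A∈y | inj₁ y⊑x with ⊑-or-witness x y
        ...   | inj₂ (F , fS , F∈x , F∉y) = ⇛-weaken there (there ∘ ∈-++⁺ʳ (x ⁻))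
                (◇-inconsistent y (smaller (length⁺-< y⊑x fS F∈x F∉y)) (⊑-trans y⊑x x⊑w) ◇A∈y)
        ...   | inj₁ x⊑y with search (_≈? y) Ws
        ...     | no ¬∃ = ⇛-weaken there (there ∘ ∈-++⁺ʳ (x ⁻)) (complete y ¬∃)
        ...     | yes (v , vW , v⊑y , y⊑v) = ⇛-intro (inl (app (thm E-from-v) (⋀-⊆ (⁺-mono v⊑y) (snd v₀))))
          where
          E-from-v : Lmin (⋀ (v ⁺) ⇒ E)
          E-from-v = ⊢⇒Lmin (lam (app (thm (□⇒⋁-mono (concatMap⁺ ◇⁻¹ (⁻-antitone (⊑-trans x⊑y y⊑v)))))
            (app (thm (□⇒-rule (□⇒-premise vW (⊑-trans v⊑y (⊑-trans y⊑x x⊑w))) (map-□-unbox (v ⁺)))) v₀)))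

    realised-or-inconsistent : ∀ w {F} → F ∈ S → Realised Ws w F ⊎ Inconsistent w
    realised-or-inconsistent w {B ⇒ C} s with B ⇒ C ∈? w
    ... | yes m = inj₁ (inj₁ m)
    ... | no B⇒C∉w with search (λ y → (w ⊑? y) ×-dec (B ∈? y) ×-dec (C ∉? y)) Ws
    ...   | yes p = inj₁ (inj₂ p)
    ...   | no ¬p = inj₂ (⇒-inconsistent s B⇒C∉w ¬p)
    realised-or-inconsistent w {□ B} s with □ B ∈? w
    ... | yes m = inj₁ (inj₁ m)
    ... | no □B∉w with search (λ y → (w ⊑? y) ×-dec search (λ z → Accessible? y z ×-dec (B ∉? z)) Ws) Ws
    ...   | yes p = inj₁ (inj₂ p)
    ...   | no ¬p = inj₂ (□-Demand.□-inconsistent s ¬p w (<-wellFounded _) ⊑-refl □B∉w)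
    realised-or-inconsistent w {◇ A} s with ◇ A ∈? w
    ... | no ◇A∉w = inj₁ (inj₁ ◇A∉w)
    ... | yes ◇A∈w with search (λ y → (y ⊑? w) ×-dec search (λ z → Accessible? y z ×-dec (A ∈? z)) Ws) Ws
    ...   | yes p = inj₁ (inj₂ p)
    ...   | no ¬p = inj₂ (◇-Demand.◇-inconsistent s ¬p w (<-wellFounded _) ⊑-refl ◇A∈w)
    realised-or-inconsistent w {atom _} _ = inj₁ tt
    realised-or-inconsistent w {⊤ᶠ} _ = inj₁ tt
    realised-or-inconsistent w {⊥ᶠ} _ = inj₁ tt
    realised-or-inconsistent w {_ ∨ᶠ _} _ = inj₁ tt
    realised-or-inconsistent w {_ ∧ᶠ _} _ = inj₁ tt

    saturated-or-inconsistent : ∀ w → Saturated Ws w ⊎ Inconsistent w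
    saturated-or-inconsistent w with all-or S (local-or-inconsistent w) | all-or S (realised-or-inconsistent w)
    ... | inj₂ i | _ = inj₂ i
    ... | inj₁ _ | inj₂ i = inj₂ i
    ... | inj₁ l | inj₁ r = inj₁ record { local = l ; realised = r }

    prune : List World
    prune = filter (classifiedLeft? saturated-or-inconsistent) Ws

    prune-complete : AllConsistentIn prune
    prune-complete z z∉prune with search (_≈? z) Ws
    ... | no z∉Ws = complete z z∉Ws
    ... | yes (w , wW , w≈z) with classifiedLeft? saturated-or-inconsistent w
    ...   | yes kept = ⊥-elim (z∉prune (w , ∈-filter⁺ (classifiedLeft? saturated-or-inconsistent) wW kept , w≈z))
    ...   | no dropped = Inconsistent-resp-≈ w≈z (¬classifiedLeft⇒ saturated-or-inconsistent dropped)

    stable-or-shrinks : (∀ {w} → w ∈ Ws → Saturated Ws w) ⊎ length prune < length Ws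
    stable-or-shrinks with all? (classifiedLeft? saturated-or-inconsistent) Ws
    ... | yes all = inj₁ λ m → classifiedLeft⇒ saturated-or-inconsistent (All.lookup all m)
    ... | no ¬all = inj₂ (filter-notAll _ Ws (¬All⇒Any¬ (classifiedLeft? saturated-or-inconsistent) Ws ¬all))

  eliminate : ∀ Ws → Acc _<_ (length Ws) → AllConsistentIn Ws
            → ∃ λ Ws′ → AllConsistentIn Ws′ × (∀ {w} → w ∈ Ws′ → Saturated Ws′ w)
  eliminate Ws (acc smaller) complete with EliminationStep.stable-or-shrinks Ws complete
  ... | inj₁ saturated = Ws , complete , saturated
  ... | inj₂ shrinks = eliminate _ (smaller shrinks) (EliminationStep.prune-complete Ws complete)

  sublists-complete : AllConsistentIn (sublists S)
  sublists-complete z z∉ = ⊥-elim (z∉ (z ⁺ , filter-∈-sublists (_∈? z) S , (λ _ m → proj₂ (⁺-elim m)) , ⁺-intro))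

  module Canonical (Ws : List World) (saturated : ∀ {w} → w ∈ Ws → Saturated Ws w) where
    M : Model
    M = record
      { W = ∃ (_∈ Ws) ; _≼_ = λ (w , _) (v , _) → w ⊑ v ; ≼-refl = ⊑-refl ; ≼-trans = ⊑-trans
      ; R = λ (y , _) (z , _) → Accessible y z
      ; V = λ n (w , _) → atom n ∈ S × atom n ∈ w ; V-mono = λ w⊑v (s , m) → s , w⊑v s m }
    open Semantics M

    ⊨⇒∈ : ∀ F → F ∈ S → ∀ {w} (wW : w ∈ Ws) → (w , wW) ⊨ F → F ∈ w
    ∈⇒⊨ : ∀ F → F ∈ S → ∀ {w} (wW : w ∈ Ws) → F ∈ w → (w , wW) ⊨ F

    ⊨⇒∈ (atom n) _ _ (_ , m) = m
    ⊨⇒∈ ⊤ᶠ s wW _ = Saturated.local (saturated wW) s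
    ⊨⇒∈ (B ∧ᶠ C) s wW (b , c) =
      proj₂ (Saturated.local (saturated wW) s) (⊨⇒∈ B (proj₁ (closed s)) wW b) (⊨⇒∈ C (proj₂ (closed s)) wW c)
    ⊨⇒∈ (B ∨ᶠ C) s wW (inj₁ b) = proj₁ (proj₂ (Saturated.local (saturated wW) s)) (⊨⇒∈ B (proj₁ (closed s)) wW b)
    ⊨⇒∈ (B ∨ᶠ C) s wW (inj₂ c) = proj₂ (proj₂ (Saturated.local (saturated wW) s)) (⊨⇒∈ C (proj₂ (closed s)) wW c)
    ⊨⇒∈ (B ⇒ C) s wW h with Saturated.realised (saturated wW) s
    ... | inj₁ m = m
    ... | inj₂ (y , yW , w⊑y , B∈y , C∉y) =
      ⊥-elim (C∉y (⊨⇒∈ C (proj₂ (closed s)) yW (h (y , yW) w⊑y (∈⇒⊨ B (proj₁ (closed s)) yW B∈y))))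
    ⊨⇒∈ (□ B) s wW h with Saturated.realised (saturated wW) s
    ... | inj₁ m = m
    ... | inj₂ (y , yW , w⊑y , z , zW , r , B∉z) = ⊥-elim (B∉z (⊨⇒∈ B (closed s) zW (h (y , yW) w⊑y (z , zW) r)))
    ⊨⇒∈ (◇ A) s wW ((y , yW) , y⊑w , (z , zW) , r , a) = y⊑w s (proj₂ r s (⊨⇒∈ A (closed s) zW a))

    ∈⇒⊨ (atom n) s _ m = s , m
    ∈⇒⊨ ⊤ᶠ _ _ _ = tt
    ∈⇒⊨ ⊥ᶠ s wW m = Saturated.local (saturated wW) s m
    ∈⇒⊨ (B ∧ᶠ C) s wW m with proj₁ (Saturated.local (saturated wW) s) m
    ... | B∈w , C∈w = ∈⇒⊨ B (proj₁ (closed s)) wW B∈w , ∈⇒⊨ C (proj₂ (closed s)) wW C∈w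
    ∈⇒⊨ (B ∨ᶠ C) s wW m with proj₁ (Saturated.local (saturated wW) s) m
    ... | inj₁ B∈w = inj₁ (∈⇒⊨ B (proj₁ (closed s)) wW B∈w)
    ... | inj₂ C∈w = inj₂ (∈⇒⊨ C (proj₂ (closed s)) wW C∈w)
    ∈⇒⊨ (B ⇒ C) s wW m (y , yW) w⊑y b = ∈⇒⊨ C (proj₂ (closed s)) yW
      (Saturated.local (saturated yW) s (w⊑y s m) (⊨⇒∈ B (proj₁ (closed s)) yW b))
    ∈⇒⊨ (□ B) s wW m _ w⊑y (z , zW) r = ∈⇒⊨ B (closed s) zW (proj₁ r s (w⊑y s m))
    ∈⇒⊨ (◇ A) s wW m with Saturated.realised (saturated wW) s
    ... | inj₁ ◇A∉w = ⊥-elim (◇A∉w m)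
    ... | inj₂ (y , yW , y⊑w , z , zW , r , A∈z) = (y , yW) , y⊑w , (z , zW) , r , ∈⇒⊨ A (closed s) zW A∈z

  decide : ∀ {A} → A ∈ S → Dec (Lmin A)
  decide {A} aS with eliminate (sublists S) (<-wellFounded _) sublists-complete
  ... | Ws , complete , saturated with search (A ∉?_) Ws
  ...   | yes (w , wW , A∉w) = no λ ⊢A → A∉w (⊨⇒∈ A aS wW (soundness ⊢A M (w , wW)))
    where open Canonical Ws saturated
  ...   | no ¬∃ = yes (⊢⇒Lmin (⋁-single (⇛-elim (⇛-cut-all S by-cases) triv)))
    where
    by-cases : ∀ z → z ⁺ ⇛ A ∷ z ⁻
    by-cases z with A ∈? z | search (_≈? z) Ws
    ... | yes A∈z | _ = ⇛-axiom (⁺-intro aS A∈z) (here refl)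
    ... | no A∉z | yes (w , wW , w⊑z , _) = ⊥-elim (¬∃ (w , wW , A∉z ∘ w⊑z aS))
    ... | no _ | no z∉Ws = ⇛-weaken (λ m → m) there (complete z z∉Ws)

mainTheorem5 : (A : Formula) → Dec (Lmin A)
mainTheorem5 A = Worlds.decide (subformulas A) (subformulas-closed A) (here refl)
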